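{- Let $\mathcal{L}$ be the simple path on vertices $v_1,\dots,v_n$ with edges $\{v_1,v_2\},\{v_2,v_3\},\dots,\{v_{n-1},v_n\}$. Then for all $1\le i<j\le n$ and all $\alpha\in\mathbb{Z}^n$, \[T_{[i,j]}(\alpha)=\alpha-\epsilon_i+\epsilon_j.\]
   Context: For a graph with vertices $v_1,\dots,v_n$: $\epsilon_i\in\mathbb{Z}^n$ is the $i$th standard basis vector, $d_i$ the degree of $v_i$, $\Delta_i=\big(\sum_{j:\{v_j,v_i\}\in E}\epsilon_j\big)-d_i\epsilon_i$, and the toppling $T_i:\mathbb{Z}^n\to\mathbb{Z}^n$ is $T_i(\alpha)=\alpha+\Delta_i$. $T_{[i]}=T_1T_2\cdots T_i$, and $T_{[i,j]}=T_{[i]}T_{[i+1]}\cdots T_{[j-1]}$ for $1\le i<j\le n$. -}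

module Defs where

open import Data.Nat as ℕ using (ℕ; zero; suc; _<?_; _≡ᵇ_)
open import Data.Integer as ℤ using (ℤ; +_; _+_; _-_; 0ℤ; 1ℤ)
open import Data.Fin using (Fin; toℕ; fromℕ<) renaming (zero to fz; suc to fs)
open import Data.Fin.Properties using (_≟_)
open import Data.Bool using (Bool; true; false; if_then_else_; _∨_)
open import Data.List using (List; foldr; applyUpTo)
open import Relation.Nullary using (yes; no; does)
open import Function using (_∘_; id)

-- Configurations: vectors in ℤ^n, indexed by the vertices Fin n
-- (vertex v_k of the paper is the Fin index k-1).
Config : ℕ → Set
Config n = Fin n → ℤ

Adj : ℕ → Set
Adj n = Fin n → Fin n → Bool

Σ : ∀ {n} → (Fin n → ℤ) → ℤ
Σ {zero}  f = 0ℤ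
Σ {suc n} f = f fz + Σ (f ∘ fs)

[_] : Bool → ℤ
[ true ]  = 1ℤ
[ false ] = 0ℤ

ε : ∀ {n} → Fin n → Config n
ε i k = [ does (k ≟ i) ]

deg : ∀ {n} → Adj n → Fin n → ℤ
deg G i = Σ (λ j → [ G j i ])

Δ : ∀ {n} → Adj n → Fin n → Config n
Δ G i k = [ G k i ] - deg G i ℤ.* ε i k

T : ∀ {n} → Adj n → Fin n → Config n → Config n
T G i α k = α k + Δ G i k

-- toppling at the vertex with 0-based index m (m < n always in use below)
Tℕ : ∀ {n} → Adj n → ℕ → Config n → Config n
Tℕ {n} G m with m <? n
... | yes p = T G (fromℕ< p)
... | no _  = id

compose : ∀ {A : Set} → List (A → A) → A → A
compose = foldr (λ f g → f ∘ g) id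

-- T_{[i]} = T_1 T_2 ⋯ T_i  (1-based i; vertex v_k has 0-based index k-1)
Tpre : ∀ {n} → Adj n → ℕ → Config n → Config n
Tpre G i = compose (applyUpTo (Tℕ G) i)

-- T_{[i,j]} = T_{[i]} T_{[i+1]} ⋯ T_{[j-1]}  (1-based i < j)
Tseg : ∀ {n} → Adj n → ℕ → ℕ → Config n → Config n
Tseg G i j = compose (applyUpTo (λ t → Tpre G (i ℕ.+ t)) (j ℕ.∸ i))

pathGraph : (n : ℕ) → Adj n
pathGraph n a b = (suc (toℕ a) ≡ᵇ toℕ b) ∨ (suc (toℕ b) ≡ᵇ toℕ a)

-- Every toppling, hence every composite of topplings, is a translation of ℤⁿ, so
-- only the displacements matter. On the path Δ_1 = ε_2 − ε_1 and
-- Δ_m = ε_{m−1} + ε_{m+1} − 2ε_m for 1 < m < n, so the displacement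
-- Δ_1 + ⋯ + Δ_m of T_{[m]} is ε_{m+1} − ε_m by induction on m, and the
-- displacements of T_{[i]}, …, T_{[j−1]} telescope to ε_j − ε_i.
module Submission where

open import Defs
open import Data.Nat as ℕ using (ℕ; zero; suc; _≤_; _<_; _<?_; _≡ᵇ_; s≤s; z<s; s<s)
open import Data.Nat.Properties
  using (<⇒≤; <-trans; ≤-<-trans; n<1+n; +-monoʳ-<; +-suc; m≤n⇒∃[o]m+o≡n; m+n∸m≡n)
  renaming (+-identityʳ to ℕ-+-identityʳ)
open import Data.Integer as ℤ using (ℤ; 0ℤ; 1ℤ; _+_; _-_)
open import Data.Integer.Properties using (+-identityˡ; +-identityʳ; +-inverseʳ; *-identityˡ)
open import Data.Integer.Tactic.RingSolver using (solve-∀)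
open import Data.Fin using (Fin; toℕ; fromℕ<) renaming (zero to fz; suc to fs)
open import Data.Fin.Properties using (_≟_; toℕ-fromℕ<; toℕ<n)
open import Data.Bool using (Bool; _∨_)
open import Data.List using (applyUpTo)
open import Data.Product using (_,_)
open import Function using (_∘_; _$_)
open import Relation.Nullary using (yes; no; does; contradiction)
open import Relation.Binary.PropositionalEquality
  using (_≡_; refl; sym; trans; cong; cong₂; subst; module ≡-Reasoning)

private
  variable
    n m : ℕ

IsTranslation : (Config n → Config n) → Config n → Set
IsTranslation f d = ∀ α k → f α k ≡ α k + d k

translation-cong : ∀ {f : Config n → Config n} {d e : Config n} →
  (∀ k → d k ≡ e k) → IsTranslation f d → IsTranslation f e
translation-cong d≗e f-d α k = trans (f-d α k) (cong (α k +_) (d≗e k))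

translation-∘ : ∀ {f g : Config n → Config n} {d e : Config n} →
  IsTranslation f d → IsTranslation g e → IsTranslation (f ∘ g) (λ k → e k + d k)
translation-∘ {f = f} {g} {d} {e} f-d g-e α k = begin
  f (g α) k         ≡⟨ f-d (g α) k ⟩
  g α k + d k       ≡⟨ cong (_+ d k) (g-e α k) ⟩
  α k + e k + d k   ≡⟨ ℤ-assoc (α k) (e k) (d k) ⟩
  α k + (e k + d k) ∎
  where
  open ≡-Reasoning
  ℤ-assoc : ∀ a b c → a + b + c ≡ a + (b + c)
  ℤ-assoc = solve-∀

compose-applyUpTo-suc : ∀ {A : Set} (f : ℕ → A → A) m →
  compose (applyUpTo f (suc m)) ≡ compose (applyUpTo f m) ∘ f m
compose-applyUpTo-suc f zero    = refl
compose-applyUpTo-suc f (suc m) = cong (f 0 ∘_) (compose-applyUpTo-suc (f ∘ suc) m)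

compose-telescoping : ∀ (f : ℕ → Config n → Config n) (h : ℕ → Config n) L →
  (∀ t → t < L → IsTranslation (f t) (λ k → h (suc t) k - h t k)) →
  IsTranslation (compose (applyUpTo f L)) (λ k → h L k - h 0 k)
compose-telescoping f h zero    _    =
  translation-cong (λ k → sym (+-inverseʳ (h 0 k))) (λ α k → sym (+-identityʳ (α k)))
compose-telescoping f h (suc L) fs-h =
  translation-cong (λ k → telescope (h 0 k) (h 1 k) (h (suc L) k))
    (translation-∘ (fs-h 0 z<s)
      (compose-telescoping (f ∘ suc) (h ∘ suc) L (λ t t<L → fs-h (suc t) (s<s t<L))))
  where
  telescope : ∀ a b c → c - b + (b - a) ≡ c - a
  telescope = solve-∀

Σ-cong : ∀ {f g : Fin n → ℤ} → (∀ j → f j ≡ g j) → Σ f ≡ Σ g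
Σ-cong {zero}  f≗g = refl
Σ-cong {suc n} f≗g = cong₂ _+_ (f≗g fz) (Σ-cong (f≗g ∘ fs))

Σ-zero : ∀ n → Σ {n} (λ _ → 0ℤ) ≡ 0ℤ
Σ-zero zero    = refl
Σ-zero (suc n) = trans (+-identityˡ _) (Σ-zero n)

Σ-+ : ∀ (f g : Fin n → ℤ) → Σ (λ j → f j + g j) ≡ Σ f + Σ g
Σ-+ {zero}  f g = refl
Σ-+ {suc n} f g = trans (cong (f fz + g fz +_) (Σ-+ (f ∘ fs) (g ∘ fs)))
                        (interchange (f fz) (g fz) (Σ (f ∘ fs)) (Σ (g ∘ fs)))
  where
  interchange : ∀ a b c d → a + b + (c + d) ≡ a + c + (b + d)
  interchange = solve-∀

-- ε restricted to Fin n, but indexed by ℕ (the zero vector for m ≥ n).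
εℕ : ℕ → Config n
εℕ m k = [ toℕ k ≡ᵇ m ]

Σ-εℕ : ∀ c → c < n → Σ (εℕ {n} c) ≡ 1ℤ
Σ-εℕ {suc n} zero    _         = cong (1ℤ +_) (Σ-zero n)
Σ-εℕ {suc n} (suc c) (s≤s c<n) = trans (+-identityˡ _) (Σ-εℕ c c<n)

does-≟ : ∀ (k i : Fin n) → does (k ≟ i) ≡ (toℕ k ≡ᵇ toℕ i)
does-≟ fz     fz     = refl
does-≟ fz     (fs i) = refl
does-≟ (fs k) fz     = refl
does-≟ (fs k) (fs i) = does-≟ k i

ε≗εℕ : ∀ (i k : Fin n) → ε i k ≡ εℕ (toℕ i) k
ε≗εℕ i k = cong [_] (does-≟ k i)

-- pathGraph n a b unfolds to pathAdj (toℕ a) (toℕ b).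
pathAdj : ℕ → ℕ → Bool
pathAdj a b = (suc a ≡ᵇ b) ∨ (suc b ≡ᵇ a)

pathAdj-zero : ∀ a → [ pathAdj a 0 ] ≡ [ a ≡ᵇ 1 ]
pathAdj-zero zero          = refl
pathAdj-zero (suc zero)    = refl
pathAdj-zero (suc (suc a)) = refl

pathAdj-suc : ∀ a m → [ pathAdj a (suc m) ] ≡ [ a ≡ᵇ m ] + [ a ≡ᵇ suc (suc m) ]
pathAdj-suc zero                zero    = refl
pathAdj-suc zero                (suc m) = refl
pathAdj-suc (suc zero)          zero    = refl
pathAdj-suc (suc (suc zero))    zero    = refl
pathAdj-suc (suc (suc (suc a))) zero    = refl
pathAdj-suc (suc a)             (suc m) = pathAdj-suc a m

pathDegree : ℕ → ℕ → ℤ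
pathDegree n m = Σ {n} (λ j → [ pathAdj (toℕ j) m ])

pathDegree-zero : 1 < n → pathDegree n 0 ≡ 1ℤ
pathDegree-zero {n} 1<n = trans (Σ-cong {n} (pathAdj-zero ∘ toℕ)) (Σ-εℕ 1 1<n)

pathDegree-suc : suc (suc m) < n → pathDegree n (suc m) ≡ ℤ.+ 2
pathDegree-suc {m} {n} m+2<n = begin
  pathDegree n (suc m)                      ≡⟨ Σ-cong {n} (λ j → pathAdj-suc (toℕ j) m) ⟩
  Σ (λ j → εℕ {n} m j + εℕ (suc (suc m)) j) ≡⟨ Σ-+ (εℕ {n} m) (εℕ (suc (suc m))) ⟩
  Σ (εℕ {n} m) + Σ (εℕ {n} (suc (suc m)))   ≡⟨ cong₂ _+_ (Σ-εℕ m m<n) (Σ-εℕ (suc (suc m)) m+2<n) ⟩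
  ℤ.+ 2                                     ∎
  where
  open ≡-Reasoning
  m<n : m < n
  m<n = <-trans (n<1+n m) (<-trans (n<1+n (suc m)) m+2<n)

pathΔ : ℕ → Config n
pathΔ {n} m k = [ pathAdj (toℕ k) m ] - pathDegree n m ℤ.* εℕ m k

Δ-path : ∀ (a k : Fin n) → Δ (pathGraph n) a k ≡ pathΔ (toℕ a) k
Δ-path {n} a k =
  cong (λ x → [ pathAdj (toℕ k) (toℕ a) ] - pathDegree n (toℕ a) ℤ.* x) (ε≗εℕ a k)

pathΔ-zero : 1 < n → ∀ (k : Fin n) → pathΔ 0 k ≡ εℕ 1 k - εℕ 0 k
pathΔ-zero 1<n k = trans
  (cong₂ (λ x y → x - y ℤ.* εℕ 0 k) (pathAdj-zero (toℕ k)) (pathDegree-zero 1<n))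
  (cong (εℕ 1 k -_) (*-identityˡ (εℕ 0 k)))

pathΔ-suc : suc (suc m) < n → ∀ (k : Fin n) →
  pathΔ (suc m) k ≡ εℕ m k + εℕ (suc (suc m)) k - ℤ.+ 2 ℤ.* εℕ (suc m) k
pathΔ-suc {m} m+2<n k =
  cong₂ (λ x y → x - y ℤ.* εℕ (suc m) k) (pathAdj-suc (toℕ k) m) (pathDegree-suc m+2<n)

Tℕ-path : m < n → IsTranslation (Tℕ (pathGraph n) m) (pathΔ m)
Tℕ-path {m} {n} m<n with m <? n
... | yes p = λ α k →
  cong (α k +_) (trans (Δ-path (fromℕ< p) k) (cong (λ x → pathΔ x k) (toℕ-fromℕ< p)))
... | no m≮n = contradiction m<n m≮n

Tpre-path : suc m < n → IsTranslation (Tpre (pathGraph n) (suc m)) (λ k → εℕ (suc m) k - εℕ m k)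
Tpre-path {zero}  1<n = translation-cong (pathΔ-zero 1<n) (Tℕ-path (<-trans (n<1+n 0) 1<n))
Tpre-path {suc m} {n} m+2<n =
  subst (λ f → IsTranslation f (λ k → εℕ (suc (suc m)) k - εℕ (suc m) k))
        (sym (compose-applyUpTo-suc (Tℕ (pathGraph n)) (suc m))) $
  translation-cong displacement (translation-∘ (Tpre-path m+1<n) (Tℕ-path m+1<n))
  where
  m+1<n : suc m < n
  m+1<n = <-trans (n<1+n (suc m)) m+2<n

  shift : ∀ a b c → a + c - ℤ.+ 2 ℤ.* b + (b - a) ≡ c - b
  shift = solve-∀

  displacement : ∀ k → pathΔ (suc m) k + (εℕ (suc m) k - εℕ m k) ≡ εℕ (suc (suc m)) k - εℕ (suc m) k
  displacement k = trans (cong (_+ (εℕ (suc m) k - εℕ m k)) (pathΔ-suc m+2<n k))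
                         (shift (εℕ m k) (εℕ (suc m) k) (εℕ (suc (suc m)) k))

Tseg-path : ∀ {I J} → I ≤ J → J < n →
  IsTranslation (Tseg (pathGraph n) (suc I) (suc J)) (λ k → εℕ J k - εℕ I k)
Tseg-path {n} {I} I≤J J<n with m≤n⇒∃[o]m+o≡n I≤J
... | L , refl rewrite m+n∸m≡n I L =
  translation-cong (λ k → cong (λ x → εℕ (I ℕ.+ L) k - εℕ x k) (ℕ-+-identityʳ I))
    (compose-telescoping _ (λ t → εℕ (I ℕ.+ t)) L step)
  where
  step : ∀ t → t < L →
    IsTranslation (Tpre (pathGraph n) (suc (I ℕ.+ t))) (λ k → εℕ (I ℕ.+ suc t) k - εℕ (I ℕ.+ t) k)
  step t t<L rewrite +-suc I t = Tpre-path (≤-<-trans (+-monoʳ-< I t<L) J<n)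

mainTheorem11 : (n : ℕ) → (i j : Fin n) → toℕ i < toℕ j →
    (α : Config n) → (k : Fin n) →
    Tseg (pathGraph n) (suc (toℕ i)) (suc (toℕ j)) α k ≡ α k - ε i k + ε j k
mainTheorem11 n i j i<j α k = begin
  Tseg (pathGraph n) (suc (toℕ i)) (suc (toℕ j)) α k  ≡⟨ Tseg-path (<⇒≤ i<j) (toℕ<n j) α k ⟩
  α k + (εℕ (toℕ j) k - εℕ (toℕ i) k)
    ≡⟨ cong₂ (λ x y → α k + (x - y)) (sym (ε≗εℕ j k)) (sym (ε≗εℕ i k)) ⟩
  α k + (ε j k - ε i k)                               ≡⟨ reassociate (α k) (ε i k) (ε j k) ⟩
  α k - ε i k + ε j k                                 ∎
  where
  open ≡-Reasoning
  reassociate : ∀ a b c → a + (c - b) ≡ a - b + c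
  reassociate = solve-∀
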